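{- Let $d\ge1$, $N\ge2$ be integers, $P=(0,N)^d\cap\mathbb{Z}^d$, let $l$ be an integer with $0\le l\le\lfloor\log_2 N\rfloor-1$, and let $\alpha\ge1$. Then every $d$-cube $C\subseteq(0,N)^d$ of width at most $\alpha 2^{l+2}$ contains at most $(4\alpha+1)^d$ points of $P$ of level $l$.
   Context: A $d$-cube is an axis-parallel $d$-dimensional hypercube; its width is its side length. For a positive integer $i$, $\ell(i)$ is the largest integer $k\ge0$ such that $2^k$ divides $i$. For $x=(x_1,\dots,x_d)\in P$, its level is $\ell(x)=\min_{1\le i\le d}\ell(x_i)$.
   Formalization: The parameter α and the corner coordinates and width of each d-cube C are taken in the rationals. -}

module Defs where

open import Data.Nat as ℕ using (ℕ; zero; suc; _^_)
open import Data.Nat.Divisibility using (_∣_)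
open import Data.Fin using (Fin)
open import Data.Vec using (Vec; lookup)
open import Data.Product using (Σ; ∃; _×_)
open import Data.Rational as ℚ using (ℚ; 0ℚ; 1ℚ)
open import Data.Integer using (+_)
open import Relation.Binary.PropositionalEquality using (_≡_)

IsVal : ℕ → ℕ → Set
IsVal i k = (2 ^ k ∣ i) × (∀ j → 2 ^ j ∣ i → j ℕ.≤ k)

-- Level of a point x : ℓ(x) = min_i ℓ(x_i).  HasLevel x l  means  ℓ(x) = l,
-- i.e. with v i = ℓ(x_i): l is a lower bound of all v i and is attained.
HasLevel : ∀ {d} → Vec ℕ d → ℕ → Set
HasLevel {d} x l =
  Σ (Fin d → ℕ) λ v →
    (∀ i → IsVal (lookup x i) (v i)) × (∀ i → l ℕ.≤ v i) × ∃ λ i → v i ≡ l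

InP : ∀ {d} → ℕ → Vec ℕ d → Set
InP N x = ∀ i → (0 ℕ.< lookup x i) × (lookup x i ℕ.< N)

toℚ : ℕ → ℚ
toℚ n = (+ n) ℚ./ 1

_^ℚ_ : ℚ → ℕ → ℚ
q ^ℚ zero = 1ℚ
q ^ℚ suc n = q ℚ.* (q ^ℚ n)

InCube : ∀ {d} → (Fin d → ℚ) → ℚ → Vec ℕ d → Set
InCube a w x = ∀ i → (a i ℚ.≤ toℚ (lookup x i)) × (toℚ (lookup x i) ℚ.≤ a i ℚ.+ w)

CubeInBox : ∀ {d} → ℕ → (Fin d → ℚ) → ℚ → Set
CubeInBox N a w = ∀ i → (0ℚ ℚ.< a i) × (a i ℚ.+ w ℚ.< toℚ N)

{-# OPTIONS --safe #-}
module Submission where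

-- Every coordinate of a point of level l is divisible by 2^l. In each direction the cube is an
-- interval of width at most 4α·2^l, and between the least and the greatest multiple of 2^l in
-- such an interval there are at most 4α steps of size 2^l, so it contains at most 4α + 1 of
-- them. Hence the points of level l in the cube lie in a grid with at most 4α + 1 values per
-- coordinate, and being distinct they number at most (4α + 1)^d.

open import Defs
open import Data.Nat using (ℕ; _≤_; _+_; _^_)
open import Data.Nat.Logarithm using (⌊log₂_⌋)
open import Data.Fin using (Fin)
open import Data.Vec using (Vec)
open import Data.List using (List; length)
open import Data.List.Relation.Unary.All using (All)
open import Data.List.Relation.Unary.Unique.Propositional using (Unique)
open import Data.Product using (_×_)
open import Data.Rational as ℚ using (ℚ; 0ℚ; 1ℚ)

open import Data.Nat as ℕ using (zero; suc; _*_; _∸_; s≤s; NonZero)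
import Data.Nat.Properties as ℕP
open import Data.Nat.Coprimality as Coprime using ()
open import Data.Nat.Divisibility using (_∣_; divides; ∣-trans)
open import Data.Integer as ℤ using (+_)
import Data.Integer.Properties as ℤP
import Data.Rational.Properties as ℚP
open import Data.Rational.Solver using (module +-*-Solver)
open import Data.Fin as Fin using ()
open import Data.Fin.Properties using (injective⇒≤)
open import Data.Vec using ([]; _∷_; lookup)
open import Data.List using ([]; _∷_; [_]; map; applyUpTo; cartesianProductWith)
import Data.List as List
open import Data.List.Properties using (length-++; length-map; length-applyUpTo)
open import Data.List.Relation.Unary.All as All using ([]; _∷_)
import Data.List.Relation.Unary.All.Properties as All
open import Data.List.Relation.Unary.AllPairs using (_∷_)
open import Data.List.Relation.Unary.Any using (here; there; index)
open import Data.List.Membership.Propositional using (_∈_)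
open import Data.List.Membership.Propositional.Properties
  using (∈-lookup; ∈-map⁺; ∈-applyUpTo⁺; ∈-cartesianProductWith⁺)
open import Data.List.Membership.Setoid.Properties using (index-injective)
open import Data.List.Relation.Binary.Subset.Propositional using (_⊆_)
import Data.List.Extrema ℕP.≤-totalOrder as Extrema
open import Data.Product using (∃-syntax; _,_; proj₁; proj₂)
open import Function using (_∘_; id)
open import Function.Definitions using (Injective)
open import Relation.Binary.PropositionalEquality
  using (_≡_; refl; sym; cong; cong₂; subst; subst₂; setoid; module ≡-Reasoning)
open import Relation.Nullary using (contradiction)

private
  variable
    A B C : Set

toℚ≡mkℚ : ∀ n → toℚ n ≡ ℚ.mkℚ (+ n) 0 (Coprime.sym (Coprime.1-coprimeTo n))
toℚ≡mkℚ n = ℚP.normalize-coprime (Coprime.sym (Coprime.1-coprimeTo n))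

toℚ-+ : ∀ m n → toℚ (m + n) ≡ toℚ m ℚ.+ toℚ n
toℚ-+ m n = begin
  toℚ (m + n)                               ≡⟨ ℚP./-cong +m*1+n*1≡+[m+n] refl ⟨
  (+ m ℤ.* ℤ.1ℤ ℤ.+ + n ℤ.* ℤ.1ℤ) ℚ./ 1   ≡⟨ cong₂ ℚ._+_ (toℚ≡mkℚ m) (toℚ≡mkℚ n) ⟨
  toℚ m ℚ.+ toℚ n                           ∎
  where
  open ≡-Reasoning
  +m*1+n*1≡+[m+n] : + m ℤ.* ℤ.1ℤ ℤ.+ + n ℤ.* ℤ.1ℤ ≡ + (m + n)
  +m*1+n*1≡+[m+n] = cong₂ ℤ._+_ (ℤP.*-identityʳ (+ m)) (ℤP.*-identityʳ (+ n))

toℚ-* : ∀ m n → toℚ (m * n) ≡ toℚ m ℚ.* toℚ n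
toℚ-* m n = begin
  toℚ (m * n)             ≡⟨ ℚP./-cong (ℤP.pos-* m n) refl ⟩
  (+ m ℤ.* + n) ℚ./ 1    ≡⟨ cong₂ ℚ._*_ (toℚ≡mkℚ m) (toℚ≡mkℚ n) ⟨
  toℚ m ℚ.* toℚ n         ∎
  where open ≡-Reasoning

toℚ-mono-≤ : ∀ {m n} → m ≤ n → toℚ m ℚ.≤ toℚ n
toℚ-mono-≤ {m} {n} m≤n rewrite toℚ≡mkℚ m | toℚ≡mkℚ n =
  ℚ.*≤* (ℤP.*-monoʳ-≤-nonNeg (+ 1) (ℤ.+≤+ m≤n))

toℚ-nonNegative : ∀ n → ℚ.NonNegative (toℚ n)
toℚ-nonNegative n = subst ℚ.NonNegative (sym (toℚ≡mkℚ n)) _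

toℚ-positive : ∀ n .{{_ : NonZero n}} → ℚ.Positive (toℚ n)
toℚ-positive n = ℚ.positive (ℚP.<-≤-trans (ℚP.positive⁻¹ 1ℚ) (toℚ-mono-≤ (ℕ.>-nonZero⁻¹ n)))

+-cancelˡ-≤ : ∀ r {p q} → r ℚ.+ p ℚ.≤ r ℚ.+ q → p ℚ.≤ q
+-cancelˡ-≤ r {p} {q} r+p≤r+q =
  subst₂ ℚ._≤_ (-r+[r+x]≡x p) (-r+[r+x]≡x q) (ℚP.+-monoʳ-≤ (ℚ.- r) r+p≤r+q)
  where
  open +-*-Solver
  -r+[r+x]≡x : ∀ x → ℚ.- r ℚ.+ (r ℚ.+ x) ≡ x
  -r+[r+x]≡x = solve 2 (λ r x → (:- r) :+ (r :+ x) := x) refl r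

Unique⇒lookup-injective : ∀ {xs : List A} → Unique xs → Injective _≡_ _≡_ (List.lookup xs)
Unique⇒lookup-injective (x∉xs ∷ _) {Fin.zero} {Fin.zero} _ = refl
Unique⇒lookup-injective (x∉xs ∷ _) {Fin.zero} {Fin.suc j} x≡xs[j] =
  contradiction x≡xs[j] (All.lookup x∉xs (∈-lookup j))
Unique⇒lookup-injective (x∉xs ∷ _) {Fin.suc i} {Fin.zero} xs[i]≡x =
  contradiction (sym xs[i]≡x) (All.lookup x∉xs (∈-lookup i))
Unique⇒lookup-injective (_ ∷ unique) {Fin.suc i} {Fin.suc j} xs[i]≡xs[j] =
  cong Fin.suc (Unique⇒lookup-injective unique xs[i]≡xs[j])

Unique⇒length-≤ : ∀ {xs ys : List A} → Unique xs → xs ⊆ ys → length xs ≤ length ys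
Unique⇒length-≤ {xs = xs} unique xs⊆ys = injective⇒≤ {f = index ∘ xs⊆ys ∘ ∈-lookup}
  (Unique⇒lookup-injective unique
    ∘ index-injective (setoid _) (xs⊆ys (∈-lookup _)) (xs⊆ys (∈-lookup _)))

length-cartesianProductWith : ∀ (f : A → B → C) xs ys →
  length (cartesianProductWith f xs ys) ≡ length xs * length ys
length-cartesianProductWith f []       ys = refl
length-cartesianProductWith f (x ∷ xs) ys = begin
  length (map (f x) ys List.++ cartesianProductWith f xs ys)      ≡⟨ length-++ (map (f x) ys) ⟩
  length (map (f x) ys) + length (cartesianProductWith f xs ys)
    ≡⟨ cong₂ _+_ (length-map (f x) ys) (length-cartesianProductWith f xs ys) ⟩
  length ys + length xs * length ys                                ∎
  where open ≡-Reasoning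

grid : ∀ {d} → (Fin d → List A) → List (Vec A d)
grid {d = zero}  S = [ [] ]
grid {d = suc d} S = cartesianProductWith _∷_ (S Fin.zero) (grid (S ∘ Fin.suc))

∈-grid : ∀ {d} {S : Fin d → List A} {v : Vec A d} → (∀ i → lookup v i ∈ S i) → v ∈ grid S
∈-grid {v = []}    _  = here refl
∈-grid {v = x ∷ v} v∈S = ∈-cartesianProductWith⁺ _∷_ (v∈S Fin.zero) (∈-grid (v∈S ∘ Fin.suc))

length-grid-≤ : ∀ {d} {S : Fin d → List A} {b : ℚ} →
  (∀ i → toℚ (length (S i)) ℚ.≤ b) → toℚ (length (grid S)) ℚ.≤ b ^ℚ d
length-grid-≤ {d = zero}  _ = ℚP.≤-refl
length-grid-≤ {d = suc d} {S} {b} |S|≤b = begin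
  toℚ (length (grid S))     ≡⟨ cong toℚ (length-cartesianProductWith _∷_ (S Fin.zero) rest) ⟩
  toℚ (s₀ * r)              ≡⟨ toℚ-* s₀ r ⟩
  toℚ s₀ ℚ.* toℚ r          ≤⟨ ℚP.*-monoʳ-≤-nonNeg (toℚ r) {{toℚ-nonNegative r}} (|S|≤b Fin.zero) ⟩
  b ℚ.* toℚ r               ≤⟨ ℚP.*-monoˡ-≤-nonNeg b {{b≥0}} (length-grid-≤ (|S|≤b ∘ Fin.suc)) ⟩
  b ℚ.* (b ^ℚ d)            ∎
  where
  open ℚP.≤-Reasoning
  s₀ = length (S Fin.zero)
  rest = grid (S ∘ Fin.suc)
  r  = length rest
  b≥0 : ℚ.NonNegative b
  b≥0 = ℚ.nonNegative (ℚP.≤-trans (ℚP.nonNegative⁻¹ (toℚ s₀) {{toℚ-nonNegative s₀}}) (|S|≤b Fin.zero))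

InInterval : ℚ → ℚ → ℕ → Set
InInterval a w y = a ℚ.≤ toℚ y × toℚ y ℚ.≤ a ℚ.+ w

progression : ℕ → ℕ → ℕ → List ℕ
progression M k n = applyUpTo (λ j → (k + j) * M) (suc n)

∈-progression : ∀ {M k n q} → k ≤ q → q ≤ k + n → q * M ∈ progression M k n
∈-progression {M} {k} {n} {q} k≤q q≤k+n =
  subst (_∈ progression M k n) (cong (_* M) (ℕP.m+[n∸m]≡n k≤q))
    (∈-applyUpTo⁺ (λ j → (k + j) * M) (s≤s (ℕP.m≤n+o⇒m∸n≤o q k q≤k+n)))

steps-in-interval-≤ : ∀ {M} .{{_ : NonZero M}} {a w c : ℚ} {k n} →
  a ℚ.≤ toℚ (k * M) → toℚ ((k + n) * M) ℚ.≤ a ℚ.+ w → w ℚ.≤ c ℚ.* toℚ M → toℚ n ℚ.≤ c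
steps-in-interval-≤ {M} {a} {w} {c} {k} {n} a≤kM [k+n]M≤a+w w≤cM =
  ℚP.*-cancelʳ-≤-pos (toℚ M) {{toℚ-positive M}} (ℚP.≤-trans nM≤w w≤cM)
  where
  open ℚP.≤-Reasoning
  nM≤w : toℚ n ℚ.* toℚ M ℚ.≤ w
  nM≤w = +-cancelˡ-≤ (toℚ (k * M)) (begin
    toℚ (k * M) ℚ.+ toℚ n ℚ.* toℚ M   ≡⟨ cong (toℚ (k * M) ℚ.+_) (toℚ-* n M) ⟨
    toℚ (k * M) ℚ.+ toℚ (n * M)       ≡⟨ toℚ-+ (k * M) (n * M) ⟨
    toℚ (k * M + n * M)               ≡⟨ cong toℚ (ℕP.*-distribʳ-+ M k n) ⟨
    toℚ ((k + n) * M)                 ≤⟨ [k+n]M≤a+w ⟩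
    a ℚ.+ w                           ≤⟨ ℚP.+-monoˡ-≤ w a≤kM ⟩
    toℚ (k * M) ℚ.+ w                 ∎)

cover-multiples-between : ∀ M .{{_ : NonZero M}} {a w c : ℚ} {lo hi} →
  w ℚ.≤ c ℚ.* toℚ M → M ∣ lo × InInterval a w lo → M ∣ hi × InInterval a w hi → lo ≤ hi →
  ∃[ S ] (∀ {y} → M ∣ y → lo ≤ y → y ≤ hi → y ∈ S) × toℚ (length S) ℚ.≤ c ℚ.+ 1ℚ
cover-multiples-between M {a} {w} {c} w≤cM
  (divides k refl , a≤kM , _) (divides k′ refl , _ , k′M≤a+w) kM≤k′M =
  progression M k n , between⇒∈ , length≤
  where
  n = k′ ∸ k
  k+n≡k′ : k + n ≡ k′
  k+n≡k′ = ℕP.m+[n∸m]≡n (ℕP.*-cancelʳ-≤ k k′ M kM≤k′M)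
  between⇒∈ : ∀ {y} → M ∣ y → k * M ≤ y → y ≤ k′ * M → y ∈ progression M k n
  between⇒∈ (divides q refl) kM≤qM qM≤k′M = ∈-progression (ℕP.*-cancelʳ-≤ k q M kM≤qM)
    (subst (q ≤_) (sym k+n≡k′) (ℕP.*-cancelʳ-≤ q k′ M qM≤k′M))
  [k+n]M≤a+w : toℚ ((k + n) * M) ℚ.≤ a ℚ.+ w
  [k+n]M≤a+w = subst (λ m → toℚ (m * M) ℚ.≤ a ℚ.+ w) (sym k+n≡k′) k′M≤a+w
  n≤c : toℚ n ℚ.≤ c
  n≤c = steps-in-interval-≤ {c = c} {k = k} a≤kM [k+n]M≤a+w w≤cM
  length≤ : toℚ (length (progression M k n)) ℚ.≤ c ℚ.+ 1ℚ
  length≤ = begin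
    toℚ (length (progression M k n))   ≡⟨ cong toℚ (length-applyUpTo (λ j → (k + j) * M) (suc n)) ⟩
    toℚ (1 + n)                        ≡⟨ cong toℚ (ℕP.+-comm 1 n) ⟩
    toℚ (n + 1)                        ≡⟨ toℚ-+ n 1 ⟩
    toℚ n ℚ.+ 1ℚ                       ≤⟨ ℚP.+-monoˡ-≤ 1ℚ n≤c ⟩
    c ℚ.+ 1ℚ                           ∎
    where open ℚP.≤-Reasoning

cover-multiples-in-interval : ∀ M .{{_ : NonZero M}} {a w c : ℚ} → 0ℚ ℚ.≤ c → w ℚ.≤ c ℚ.* toℚ M →
  (ys : List ℕ) → All (λ y → M ∣ y × InInterval a w y) ys →
  ∃[ S ] ys ⊆ S × toℚ (length S) ℚ.≤ c ℚ.+ 1ℚ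
cover-multiples-in-interval M 0≤c _ [] [] = [] , (λ ()) , ℚP.+-mono-≤ 0≤c (ℚP.nonNegative⁻¹ 1ℚ)
cover-multiples-in-interval M {a} {w} {c} _ w≤cM (y ∷ ys) ps@(p ∷ ps′) =
  let S , between⇒∈ , |S|≤c+1 = cover-multiples-between M {a} {w} {c} w≤cM
        (Extrema.argmin-all id p ps′) (Extrema.argmax-all id p ps′)
        (ℕP.≤-trans (min≤ (here refl)) (≤max (here refl)))
  in S , (λ z∈ → between⇒∈ (proj₁ (All.lookup ps z∈)) (min≤ z∈) (≤max z∈)) , |S|≤c+1
  where
  min≤ : ∀ {z} → z ∈ y ∷ ys → Extrema.min y ys ≤ z
  min≤ (here refl)  = Extrema.min≤⊤ y ys
  min≤ (there z∈ys) = All.lookup (Extrema.min≤xs y ys) z∈ys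
  ≤max : ∀ {z} → z ∈ y ∷ ys → z ≤ Extrema.max y ys
  ≤max (here refl)  = Extrema.⊥≤max y ys
  ≤max (there z∈ys) = All.lookup (Extrema.xs≤max y ys) z∈ys

^-monoʳ-∣ : ∀ m {i j} → i ≤ j → m ^ i ∣ m ^ j
^-monoʳ-∣ m {i} {j} i≤j = divides (m ^ (j ∸ i)) (begin
  m ^ j                 ≡⟨ cong (m ^_) (ℕP.m∸n+n≡m i≤j) ⟨
  m ^ (j ∸ i + i)       ≡⟨ ℕP.^-distribˡ-+-* m (j ∸ i) i ⟩
  m ^ (j ∸ i) * m ^ i   ∎)
  where open ≡-Reasoning

HasLevel⇒2^l∣lookup : ∀ {d} {x : Vec ℕ d} {l} → HasLevel x l → ∀ i → 2 ^ l ∣ lookup x i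
HasLevel⇒2^l∣lookup (_ , isVal , l≤v , _) i = ∣-trans (^-monoʳ-∣ 2 (l≤v i)) (proj₁ (isVal i))

lemma2 : (d N l : ℕ) → 1 ≤ d → 2 ≤ N → l + 1 ≤ ⌊log₂ N ⌋ →
    (α : ℚ) → 1ℚ ℚ.≤ α →
    (a : Fin d → ℚ) (w : ℚ) → 0ℚ ℚ.< w → CubeInBox N a w →
    w ℚ.≤ α ℚ.* toℚ (2 ^ (l + 2)) →
    (xs : List (Vec ℕ d)) → Unique xs →
    All (λ x → InP N x × InCube a w x × HasLevel x l) xs →
    toℚ (length xs) ℚ.≤ ((toℚ 4 ℚ.* α ℚ.+ 1ℚ) ^ℚ d)
lemma2 d N l _ _ _ α 1≤α a w _ _ w≤α2^[l+2] xs unique points =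
  ℚP.≤-trans (toℚ-mono-≤ (Unique⇒length-≤ unique xs⊆grid)) (length-grid-≤ (proj₂ ∘ proj₂ ∘ cover))
  where
  M = 2 ^ l
  instance
    M≢0 : NonZero M
    M≢0 = ℕP.m^n≢0 2 l
  c = toℚ 4 ℚ.* α
  0≤c : 0ℚ ℚ.≤ c
  0≤c = ℚP.*-monoˡ-≤-nonNeg (toℚ 4) {{toℚ-nonNegative 4}} (ℚP.≤-trans (ℚP.nonNegative⁻¹ 1ℚ) 1≤α)
  w≤cM : w ℚ.≤ c ℚ.* toℚ M
  w≤cM = subst (w ℚ.≤_) (begin
    α ℚ.* toℚ (2 ^ (l + 2))     ≡⟨ cong (λ m → α ℚ.* toℚ m) (ℕP.^-distribˡ-+-* 2 l 2) ⟩
    α ℚ.* toℚ (M * 4)           ≡⟨ cong (α ℚ.*_) (toℚ-* M 4) ⟩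
    α ℚ.* (toℚ M ℚ.* toℚ 4)     ≡⟨ solve 3 (λ α m f → α :* (m :* f) := (f :* α) :* m) refl
                                          α (toℚ M) (toℚ 4) ⟩
    c ℚ.* toℚ M                 ∎) w≤α2^[l+2]
    where open ≡-Reasoning; open +-*-Solver
  cover : (i : Fin d) → ∃[ S ] map (λ x → lookup x i) xs ⊆ S × toℚ (length S) ℚ.≤ c ℚ.+ 1ℚ
  cover i = cover-multiples-in-interval M 0≤c w≤cM (map (λ x → lookup x i) xs)
    (All.map⁺ (All.map (λ {x} (_ , x∈cube , level) →
      HasLevel⇒2^l∣lookup {x = x} level i , x∈cube i) points))
  xs⊆grid : xs ⊆ grid (proj₁ ∘ cover)
  xs⊆grid x∈xs = ∈-grid (λ i → proj₁ (proj₂ (cover i)) (∈-map⁺ (λ x → lookup x i) x∈xs))
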